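{- Let $i\ge2$ and let $g\in G$ be a Gödel numbering. There exists a constant $M$ such that for all $x\in X_i^*$, $\rho^1_g(x)\le M$, where $\rho^1_g(x)=H_2(g(x))/|x|_i$ if $x\ne\lambda$ and $\rho^1_g(\lambda)=0$.
   Context: $X_i$ is a fixed alphabet with $i\ge2$ letters, $X_i^*$ the set of finite strings over it, $\lambda$ the empty string, $|u|_i$ the length of $u$; $X_2^*$ the set of binary strings. $H_2(y)$ is the prefix-free program-size complexity of $y\in X_2^*$: the length of a shortest binary input on which a fixed universal self-delimiting (prefix-free domain) Turing machine $U_2$ outputs $y$. $G$ is the set of Gödel numberings, i.e. computable one-to-one functions $g:X_i^*\to X_2^*$. -}

module Defs where

open import Data.Nat using (ℕ; zero; suc; _+_; _*_; _≤_)
open import Data.Fin using (Fin)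
open import Data.Vec using (Vec; []; _∷_; lookup)
open import Data.List using (List; []; _∷_; length; _++_)
open import Data.Maybe using (Maybe; just; nothing)
open import Data.Product using (Σ; ∃; _×_)
open import Data.Integer using (+_)
open import Data.Rational.Unnormalised using (ℚᵘ; 0ℚᵘ; _/_)
open import Relation.Binary.PropositionalEquality using (_≡_)

-- Model of computation: partial (μ-)recursive functions on ℕ,
-- evaluated with a fuel bound (more fuel never changes a result).

data Prog : ℕ → Set where
  Z   : ∀ {n} → Prog n
  S   : Prog 1
  P   : ∀ {n} → Fin n → Prog n
  C   : ∀ {m n} → Prog m → Vec (Prog n) m → Prog n
  R   : ∀ {n} → Prog n → Prog (suc (suc n)) → Prog (suc n)
  Mu  : ∀ {n} → Prog (suc n) → Prog n

mutual
  eval : ℕ → ∀ {n} → Prog n → Vec ℕ n → Maybe ℕ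
  eval zero    _        _        = nothing
  eval (suc f) Z        xs       = just 0
  eval (suc f) S        (x ∷ []) = just (suc x)
  eval (suc f) (P i)    xs       = just (lookup xs i)
  eval (suc f) (C g hs) xs       = evalC f g (evalVec f hs xs)
  eval (suc f) (R g h)  (x ∷ xs) = rec f g h x xs
  eval (suc f) (Mu g)   xs       = search f g xs 0 f

  evalC : ℕ → ∀ {m} → Prog m → Maybe (Vec ℕ m) → Maybe ℕ
  evalC f g nothing   = nothing
  evalC f g (just ys) = eval f g ys

  evalVec : ℕ → ∀ {m n} → Vec (Prog n) m → Vec ℕ n → Maybe (Vec ℕ m)
  evalVec f []       xs = just []
  evalVec f (h ∷ hs) xs = cons (eval f h xs) (evalVec f hs xs)

  cons : ∀ {m} → Maybe ℕ → Maybe (Vec ℕ m) → Maybe (Vec ℕ (suc m))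
  cons (just y) (just ys) = just (y ∷ ys)
  cons _        _         = nothing

  rec : ℕ → ∀ {n} → Prog n → Prog (suc (suc n)) → ℕ → Vec ℕ n → Maybe ℕ
  rec f g h zero    xs = eval f g xs
  rec f g h (suc x) xs = recStep f h x (rec f g h x xs) xs

  recStep : ℕ → ∀ {n} → Prog (suc (suc n)) → ℕ → Maybe ℕ → Vec ℕ n → Maybe ℕ
  recStep f h x nothing  xs = nothing
  recStep f h x (just r) xs = eval f h (x ∷ r ∷ xs)

  search : ℕ → ∀ {n} → Prog (suc n) → Vec ℕ n → ℕ → ℕ → Maybe ℕ
  search f g xs k zero    = nothing
  search f g xs k (suc b) = searchStep f g xs k b (eval f g (k ∷ xs))

  searchStep : ℕ → ∀ {n} → Prog (suc n) → Vec ℕ n → ℕ → ℕ → Maybe ℕ → Maybe ℕ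
  searchStep f g xs k b nothing        = nothing
  searchStep f g xs k b (just zero)    = just k
  searchStep f g xs k b (just (suc _)) = search f g xs (suc k) b

_⊢_↦_ : Prog 1 → ℕ → ℕ → Set
e ⊢ x ↦ y = ∃ λ fuel → eval fuel e (x ∷ []) ≡ just y

-- Strings over X_k = Fin k, coded bijectively as naturals
-- (bijective base-k numeration).

Str : ℕ → Set
Str k = List (Fin k)

code : ∀ {k} → Str k → ℕ
code {k} []      = 0
code {k} (a ∷ w) = suc (Data.Fin.toℕ a) + k * code w

Bin : Set
Bin = Str 2

_⊢ᵇ_↦_ : Prog 1 → Bin → Bin → Set
e ⊢ᵇ p ↦ y = e ⊢ code p ↦ code y

Computable : ∀ {k} → (Str k → Bin) → Set
Computable {k} g = ∃ λ (e : Prog 1) → ∀ (x : Str k) → e ⊢ code x ↦ code (g x)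

Injective : ∀ {k} → (Str k → Bin) → Set
Injective g = ∀ x y → g x ≡ g y → x ≡ y

GödelNumbering : ℕ → Set
GödelNumbering k = Σ (Str k → Bin) λ g → Computable g × Injective g

_IsPrefixOf_ : Bin → Bin → Set
p IsPrefixOf q = ∃ λ r → p ++ r ≡ q

PrefixFree : Prog 1 → Set
PrefixFree e = ∀ p q y y' → e ⊢ᵇ p ↦ y → e ⊢ᵇ q ↦ y' → p IsPrefixOf q → p ≡ q

Universal : Prog 1 → Set
Universal u = PrefixFree u ×
  (∀ (c : Prog 1) → PrefixFree c → ∃ λ (sim : ℕ) →
     ∀ p y → c ⊢ᵇ p ↦ y → ∃ λ p' → u ⊢ᵇ p' ↦ y × length p' ≤ length p + sim)

IsH : Prog 1 → Bin → ℕ → Set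
IsH u y n = (∃ λ p → u ⊢ᵇ p ↦ y × length p ≡ n) ×
            (∀ p → u ⊢ᵇ p ↦ y → n ≤ length p)

-- ρ¹ x h = h / |x| for x ≠ λ, and 0 for x = λ   (h = H_2(g(x)))
ρ¹ : ∀ {k} → Str k → ℕ → ℚᵘ
ρ¹ []      h = 0ℚᵘ
ρ¹ (a ∷ w) h = (+ h) / suc (length w)

-- Let e compute g.  Encode a string x by the self-delimiting binary word
-- 1ᴸ 0 b, where b is the binary numeral of code x and L its length; the
-- machine that decodes such a word and then runs e is prefix-free, so
-- universality gives H₂(g x) ≤ 2L + 1 + c.  Since code x < (i + 1)^|x|,
-- L ≤ (i + 1)|x|, and H₂(g x)/|x| is bounded by a constant.
module Submission where

open import Defs
open import Data.Nat using (ℕ; zero; suc; _+_; _*_; _∸_; _^_; _≤_; _<_; _≥_; z≤n; s≤s; _⊔_; pred; ∣_-_∣; _≤′_; ≤′-refl; ≤′-step)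
open import Data.Nat.Properties
open import Data.Nat.Tactic.RingSolver using (solve-∀)
open import Data.Fin using (Fin; zero; suc; toℕ)
open import Data.Fin.Properties using (toℕ<n)
open import Data.Vec using (Vec; []; _∷_; lookup)
open import Data.List using (List; []; _∷_; length; _++_; replicate)
open import Data.List.Properties using (length-++; ++-assoc; ++-identityʳ; length-replicate; ∷-injectiveʳ)
open import Data.Maybe using (Maybe; just; nothing)
open import Data.Maybe.Properties using (just-injective)
open import Data.Product using (∃; _×_; _,_; proj₁; proj₂)
open import Data.Empty using (⊥-elim)
open import Relation.Binary.PropositionalEquality
open import Data.Integer using (+_)
import Data.Integer as ℤ
import Data.Integer.Properties as ℤ
import Data.Rational.Unnormalised as ℚ

-- Fuel monotonicity

infix 4 _⊑_

_⊑_ : ∀ {A : Set} → Maybe A → Maybe A → Set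
a ⊑ b = ∀ {y} → a ≡ just y → b ≡ just y

⊑-chain : ∀ {A : Set} (F : ℕ → Maybe A) → (∀ f → F f ⊑ F (suc f)) →
          ∀ {f f'} → f ≤ f' → F f ⊑ F f'
⊑-chain F step f≤f' = go (≤⇒≤′ f≤f')
  where
  go : ∀ {f f'} → f ≤′ f' → F f ⊑ F f'
  go ≤′-refl        e = e
  go (≤′-step f≤f') e = step _ (go f≤f' e)

cons-⊑ : ∀ {m} {a a' : Maybe ℕ} {b b' : Maybe (Vec ℕ m)} → a ⊑ a' → b ⊑ b' → cons a b ⊑ cons a' b'
cons-⊑ {a = just _}  {b = just _}  a⊑a' b⊑b' e rewrite a⊑a' refl | b⊑b' refl = e
cons-⊑ {a = just _}  {b = nothing} _ _ ()
cons-⊑ {a = nothing}               _ _ ()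

mutual
  eval-⊑-suc : ∀ f {n} (p : Prog n) xs → eval f p xs ⊑ eval (suc f) p xs
  eval-⊑-suc zero    p        xs       ()
  eval-⊑-suc (suc f) Z        xs       e = e
  eval-⊑-suc (suc f) S        (x ∷ []) e = e
  eval-⊑-suc (suc f) (P i)    xs       e = e
  eval-⊑-suc (suc f) (C g hs) xs       e = evalC-⊑-suc f g (evalVec-⊑-suc f hs xs) e
  eval-⊑-suc (suc f) (R g h)  (x ∷ xs) e = rec-⊑-suc f g h x xs e
  eval-⊑-suc (suc f) (Mu g)   xs       e = search-⊑-suc f g xs 0 f e

  evalVec-⊑-suc : ∀ f {m n} (hs : Vec (Prog n) m) xs → evalVec f hs xs ⊑ evalVec (suc f) hs xs
  evalVec-⊑-suc f []       xs e = e
  evalVec-⊑-suc f (h ∷ hs) xs e = cons-⊑ (eval-⊑-suc f h xs) (evalVec-⊑-suc f hs xs) e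

  evalC-⊑-suc : ∀ f {m} (g : Prog m) {a b : Maybe (Vec ℕ m)} → a ⊑ b → evalC f g a ⊑ evalC (suc f) g b
  evalC-⊑-suc f g {just ys} a⊑b e rewrite a⊑b refl = eval-⊑-suc f g ys e
  evalC-⊑-suc f g {nothing} _ ()

  rec-⊑-suc : ∀ f {n} (g : Prog n) h x xs → rec f g h x xs ⊑ rec (suc f) g h x xs
  rec-⊑-suc f g h zero    xs e = eval-⊑-suc f g xs e
  rec-⊑-suc f g h (suc x) xs e = recStep-⊑-suc f h x xs (rec-⊑-suc f g h x xs) e

  recStep-⊑-suc : ∀ f {n} (h : Prog (suc (suc n))) x xs {a b : Maybe ℕ} →
                  a ⊑ b → recStep f h x a xs ⊑ recStep (suc f) h x b xs
  recStep-⊑-suc f h x xs {just r}  a⊑b e rewrite a⊑b refl = eval-⊑-suc f h _ e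
  recStep-⊑-suc f h x xs {nothing} _ ()

  search-⊑-suc : ∀ f {n} (g : Prog (suc n)) xs k b → search f g xs k b ⊑ search (suc f) g xs k (suc b)
  search-⊑-suc f g xs k zero    ()
  search-⊑-suc f g xs k (suc b) e = searchStep-⊑-suc f g xs k b (eval-⊑-suc f g (k ∷ xs)) e

  searchStep-⊑-suc : ∀ f {n} (g : Prog (suc n)) xs k b {a a' : Maybe ℕ} →
                     a ⊑ a' → searchStep f g xs k b a ⊑ searchStep (suc f) g xs k (suc b) a'
  searchStep-⊑-suc f g xs k b {just zero}    a⊑a' e rewrite a⊑a' refl = e
  searchStep-⊑-suc f g xs k b {just (suc _)} a⊑a' e rewrite a⊑a' refl = search-⊑-suc f g xs (suc k) b e
  searchStep-⊑-suc f g xs k b {nothing}      _ ()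

eval-mono : ∀ {n} (p : Prog n) xs {f f'} → f ≤ f' → eval f p xs ⊑ eval f' p xs
eval-mono p xs = ⊑-chain (λ f → eval f p xs) (λ f → eval-⊑-suc f p xs)

evalVec-mono : ∀ {m n} (hs : Vec (Prog n) m) xs {f f'} → f ≤ f' → evalVec f hs xs ⊑ evalVec f' hs xs
evalVec-mono hs xs = ⊑-chain (λ f → evalVec f hs xs) (λ f → evalVec-⊑-suc f hs xs)

eval-deterministic : ∀ {n} (p : Prog n) xs {f f' y y'} →
                     eval f p xs ≡ just y → eval f' p xs ≡ just y' → y ≡ y'
eval-deterministic p xs {f} {f'} e e' =
  just-injective (trans (sym (eval-mono p xs (m≤m⊔n f f') e)) (eval-mono p xs (m≤n⊔m f f') e'))

record Computes {n} (p : Prog n) (s : Vec ℕ n → ℕ) : Set where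
  constructor computes
  field run : ∀ xs → ∃ λ f → eval f p xs ≡ just (s xs)
open Computes

record ComputesAll {m n} (hs : Vec (Prog n) m) (s : Vec ℕ n → Vec ℕ m) : Set where
  constructor computesAll
  field runAll : ∀ xs → ∃ λ f → evalVec f hs xs ≡ just (s xs)
open ComputesAll

computes-≗ : ∀ {n} {p : Prog n} {s s'} → Computes p s → s ≗ s' → Computes p s'
computes-≗ c s≗s' = computes λ xs → let f , e = run c xs in f , trans e (cong just (s≗s' xs))

Z-computes : ∀ {n} → Computes (Z {n}) (λ _ → 0)
Z-computes = computes λ _ → 1 , refl

S-computes : Computes S (λ { (x ∷ []) → suc x })
S-computes = computes λ { (x ∷ []) → 1 , refl }

P-computes : ∀ {n} (i : Fin n) → Computes (P i) (λ xs → lookup xs i)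
P-computes i = computes λ _ → 1 , refl

[]-computesAll : ∀ {n} → ComputesAll {n = n} [] (λ _ → [])
[]-computesAll = computesAll λ _ → 0 , refl

∷-computesAll : ∀ {m n} {h : Prog n} {hs : Vec (Prog n) m} {s ss} →
                Computes h s → ComputesAll hs ss → ComputesAll (h ∷ hs) (λ xs → s xs ∷ ss xs)
∷-computesAll {h = h} {hs} c cs = computesAll λ xs →
  let f₁ , e₁ = run c xs
      f₂ , e₂ = runAll cs xs
  in f₁ ⊔ f₂ , cong₂ cons (eval-mono h xs (m≤m⊔n f₁ f₂) e₁) (evalVec-mono hs xs (m≤n⊔m f₁ f₂) e₂)

C-computes : ∀ {m n} {g : Prog m} {hs : Vec (Prog n) m} {s ss} →
             Computes g s → ComputesAll hs ss → Computes (C g hs) (λ xs → s (ss xs))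
C-computes {g = g} {hs} {ss = ss} c cs = computes λ xs →
  let f₁ , e₁ = runAll cs xs
      f₂ , e₂ = run c (ss xs)
  in suc (f₁ ⊔ f₂) , trans (cong (evalC (f₁ ⊔ f₂) g) (evalVec-mono hs xs (m≤m⊔n f₁ f₂) e₁))
                           (eval-mono g (ss xs) (m≤n⊔m f₁ f₂) e₂)

primRec : ∀ {n} → (Vec ℕ n → ℕ) → (Vec ℕ (suc (suc n)) → ℕ) → ℕ → Vec ℕ n → ℕ
primRec s t zero    xs = s xs
primRec s t (suc x) xs = t (x ∷ primRec s t x xs ∷ xs)

primRec-unique : ∀ {n} s t (F : ℕ → Vec ℕ n → ℕ) → (∀ xs → s xs ≡ F 0 xs) →
                 (∀ x xs → t (x ∷ F x xs ∷ xs) ≡ F (suc x) xs) → ∀ x xs → primRec s t x xs ≡ F x xs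
primRec-unique s t F base step zero    xs = base xs
primRec-unique s t F base step (suc x) xs =
  trans (cong (λ r → t (x ∷ r ∷ xs)) (primRec-unique s t F base step x xs)) (step x xs)

R-computes : ∀ {n} {g : Prog n} {h s t} → Computes g s → Computes h t →
             Computes (R g h) (λ { (x ∷ xs) → primRec s t x xs })
R-computes {g = g} {h} {s} {t} cg ch = computes λ { (x ∷ xs) → let f , e = runRec xs x in suc f , e }
  where
  runRec : ∀ xs x → ∃ λ f → rec f g h x xs ≡ just (primRec s t x xs)
  runRec xs zero    = run cg xs
  runRec xs (suc x) =
    let f₁ , e₁ = runRec xs x
        f₂ , e₂ = run ch (x ∷ primRec s t x xs ∷ xs)
    in f₁ ⊔ f₂ , trans (cong (λ r → recStep (f₁ ⊔ f₂) h x r xs)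
                             (eval-mono (R g h) (x ∷ xs) (s≤s (m≤m⊔n f₁ f₂)) e₁))
                       (eval-mono h _ (m≤n⊔m f₁ f₂) e₂)

search-hit : ∀ f {n} (g : Prog (suc n)) xs k b → eval f g (k ∷ xs) ≡ just 0 → search f g xs k (suc b) ≡ just k
search-hit f g xs k b e rewrite e = refl

search-miss : ∀ f {n} (g : Prog (suc n)) xs k b {m} →
              eval f g (k ∷ xs) ≡ just (suc m) → search f g xs k (suc b) ≡ search f g xs (suc k) b
search-miss f g xs k b e rewrite e = refl

module _ {n} {g : Prog (suc n)} {s : Vec ℕ (suc n) → ℕ} (cg : Computes g s) (xs : Vec ℕ n) where

  search-sound : ∀ f k b {y} → search f g xs k b ≡ just y → s (y ∷ xs) ≡ 0
  search-sound f k (suc b) e with eval f g (k ∷ xs) in ev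
  search-sound f k (suc b) refl | just zero =
    let f' , e' = run cg (k ∷ xs) in sym (eval-deterministic g (k ∷ xs) {f} {f'} ev e')
  search-sound f k (suc b) e    | just (suc _) = search-sound f (suc k) b e

  Mu-sound : ∀ f {y} → eval f (Mu g) xs ≡ just y → s (y ∷ xs) ≡ 0
  Mu-sound (suc f) = search-sound f 0 f

  module _ (j : ℕ) (hit : s (j ∷ xs) ≡ 0) (miss : ∀ k → k < j → s (k ∷ xs) ≢ 0) where

    search-complete : ∀ d k → k + d ≡ j →
                      ∃ λ F → ∀ f b → F ≤ f → d < b → search f g xs k b ≡ just j
    search-complete zero k k+0≡j with trans (sym (+-identityʳ k)) k+0≡j
    ... | refl = let F , e = run cg (j ∷ xs) in
      F , λ { f (suc b) F≤f _ → search-hit f g xs j b (trans (eval-mono g _ F≤f e) (cong just hit)) }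
    search-complete (suc d) k k+1+d≡j with s (k ∷ xs) in sk
    ... | zero  = ⊥-elim (miss k (subst (k <_) k+1+d≡j (m<m+n k (s≤s z≤n))) sk)
    ... | suc _ =
      let F₁ , e = run cg (k ∷ xs)
          F₂ , r = search-complete d (suc k) (trans (sym (+-suc k d)) k+1+d≡j)
      in F₁ ⊔ F₂ , λ { f (suc b) F≤f (s≤s d<b) →
           trans (search-miss f g xs k b (trans (eval-mono g _ (≤-trans (m≤m⊔n F₁ F₂) F≤f) e) (cong just sk)))
                 (r f b (≤-trans (m≤n⊔m F₁ F₂) F≤f) d<b) }

    Mu-complete : ∃ λ f → eval f (Mu g) xs ≡ just j
    Mu-complete =
      let F , r = search-complete j 0 refl
          f = F ⊔ suc j
      in suc f , r f f (m≤m⊔n F (suc j)) (m≤n⊔m F (suc j))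

Mu-computes : ∀ {n} {g : Prog (suc n)} {s} {t : Vec ℕ n → ℕ} → Computes g s →
              (∀ xs → s (t xs ∷ xs) ≡ 0) → (∀ xs k → k < t xs → s (k ∷ xs) ≢ 0) → Computes (Mu g) t
Mu-computes {t = t} cg hit miss = computes λ xs → Mu-complete cg xs (t xs) (hit xs) (miss xs)

P₀ : ∀ {n} → Prog (suc n)
P₀ = P zero

P₁ : ∀ {n} → Prog (suc (suc n))
P₁ = P (suc zero)

P₂ : ∀ {n} → Prog (suc (suc (suc n)))
P₂ = P (suc (suc zero))

C₁ : ∀ {n} → Prog 1 → Prog n → Prog n
C₁ g h = C g (h ∷ [])

C₂ : ∀ {n} → Prog 2 → Prog n → Prog n → Prog n
C₂ g h k = C g (h ∷ k ∷ [])

C₁-computes : ∀ {n} {g : Prog 1} {h : Prog n} {s} {t : Vec ℕ n → ℕ} → Computes g s → Computes h t →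
              Computes (C₁ g h) (λ xs → s (t xs ∷ []))
C₁-computes cg ch = C-computes cg (∷-computesAll ch []-computesAll)

C₂-computes : ∀ {n} {g : Prog 2} {h k : Prog n} {s} {t u : Vec ℕ n → ℕ} →
              Computes g s → Computes h t → Computes k u → Computes (C₂ g h k) (λ xs → s (t xs ∷ u xs ∷ []))
C₂-computes cg ch ck = C-computes cg (∷-computesAll ch (∷-computesAll ck []-computesAll))

C₁-halts : ∀ {n} {g : Prog 1} {h : Prog n} {xs k y} →
           (∃ λ f → eval f h xs ≡ just k) → (∃ λ f → eval f g (k ∷ []) ≡ just y) →
           ∃ λ f → eval f (C₁ g h) xs ≡ just y
C₁-halts {g = g} {h} {xs} {k} (f₁ , e₁) (f₂ , e₂) =
  suc (f₁ ⊔ f₂) , trans (cong (λ r → evalC (f₁ ⊔ f₂) g (cons r (just [])))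
                              (eval-mono h xs (m≤m⊔n f₁ f₂) e₁))
                        (eval-mono g (k ∷ []) (m≤n⊔m f₁ f₂) e₂)

ADD : Prog 2
ADD = R P₀ (C₁ S P₁)

ADD-computes : Computes ADD (λ { (x ∷ y ∷ []) → x + y })
ADD-computes = computes-≗ (R-computes (P-computes zero) (C₁-computes S-computes (P-computes (suc zero))))
  λ { (x ∷ y ∷ []) → primRec-unique _ _ (λ { x (y ∷ []) → x + y })
                       (λ { (y ∷ []) → refl }) (λ { x (y ∷ []) → refl }) x (y ∷ []) }

PRED : Prog 1
PRED = R Z P₀

PRED-computes : Computes PRED (λ { (x ∷ []) → pred x })
PRED-computes = computes-≗ (R-computes Z-computes (P-computes zero))
  λ { (zero ∷ []) → refl ; (suc x ∷ []) → refl }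

pred-∸ : ∀ y x → pred (y ∸ x) ≡ y ∸ suc x
pred-∸ zero    zero    = refl
pred-∸ zero    (suc x) = refl
pred-∸ (suc y) zero    = refl
pred-∸ (suc y) (suc x) = pred-∸ y x

MONUS : Prog 2
MONUS = C₂ (R P₀ (C₁ PRED P₁)) P₁ P₀

MONUS-computes : Computes MONUS (λ { (x ∷ y ∷ []) → x ∸ y })
MONUS-computes = computes-≗ (C₂-computes subtractFrom (P-computes (suc zero)) (P-computes zero))
  λ { (x ∷ y ∷ []) → refl }
  where
  subtractFrom : Computes (R P₀ (C₁ PRED P₁)) (λ { (x ∷ y ∷ []) → y ∸ x })
  subtractFrom = computes-≗ (R-computes (P-computes zero) (C₁-computes PRED-computes (P-computes (suc zero))))
    λ { (x ∷ y ∷ []) → primRec-unique _ _ (λ { x (y ∷ []) → y ∸ x })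
                         (λ { (y ∷ []) → refl }) (λ { x (y ∷ []) → pred-∸ y x }) x (y ∷ []) }

∸+∸≡∣-∣ : ∀ m n → m ∸ n + (n ∸ m) ≡ ∣ m - n ∣
∸+∸≡∣-∣ zero    zero    = refl
∸+∸≡∣-∣ zero    (suc n) = refl
∸+∸≡∣-∣ (suc m) zero    = +-identityʳ (suc m)
∸+∸≡∣-∣ (suc m) (suc n) = ∸+∸≡∣-∣ m n

DIST : Prog 2
DIST = C₂ ADD MONUS (C₂ MONUS P₁ P₀)

DIST-computes : Computes DIST (λ { (x ∷ y ∷ []) → ∣ x - y ∣ })
DIST-computes = computes-≗
  (C₂-computes ADD-computes MONUS-computes (C₂-computes MONUS-computes (P-computes (suc zero)) (P-computes zero)))
  λ { (x ∷ y ∷ []) → ∸+∸≡∣-∣ x y }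

MUL : Prog 2
MUL = R Z (C₂ ADD P₂ P₁)

MUL-computes : Computes MUL (λ { (x ∷ y ∷ []) → x * y })
MUL-computes = computes-≗
  (R-computes Z-computes (C₂-computes ADD-computes (P-computes (suc (suc zero))) (P-computes (suc zero))))
  λ { (x ∷ y ∷ []) → primRec-unique _ _ (λ { x (y ∷ []) → x * y })
                       (λ { (y ∷ []) → refl }) (λ { x (y ∷ []) → refl }) x (y ∷ []) }

POW2 : Prog 1
POW2 = R (C₁ S Z) (C₂ ADD P₁ P₁)

POW2-computes : Computes POW2 (λ { (x ∷ []) → 2 ^ x })
POW2-computes = computes-≗
  (R-computes (C₁-computes S-computes Z-computes)
              (C₂-computes ADD-computes (P-computes (suc zero)) (P-computes (suc zero))))
  λ { (x ∷ []) → primRec-unique _ _ (λ { x [] → 2 ^ x })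
                   (λ { [] → refl }) (λ { x [] → cong (λ m → 2 ^ x + m) (sym (+-identityʳ (2 ^ x))) }) x [] }

-- Bijective binary numerals

-- In bijective base 2 the letter zero is the digit 1 and suc zero the digit 2.
b₀ b₁ : Fin 2
b₀ = zero
b₁ = suc zero

incr : Bin → Bin
incr []             = b₀ ∷ []
incr (zero ∷ w)     = b₁ ∷ w
incr (suc zero ∷ w) = b₀ ∷ incr w

code-incr : ∀ w → code (incr w) ≡ suc (code w)
code-incr []             = refl
code-incr (zero ∷ w)     = refl
code-incr (suc zero ∷ w) = trans (cong (λ c → suc (2 * c)) (code-incr w)) (cong suc (*-suc 2 (code w)))

decode : ℕ → Bin
decode zero    = []
decode (suc k) = incr (decode k)

code-decode : ∀ k → code (decode k) ≡ k
code-decode zero    = refl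
code-decode (suc k) = trans (code-incr (decode k)) (cong suc (code-decode k))

code-injective : ∀ (u v : Bin) → code u ≡ code v → u ≡ v
code-injective []             []             e = refl
code-injective (zero ∷ u)     (zero ∷ v)     e =
  cong (b₀ ∷_) (code-injective u v (*-cancelˡ-≡ (code u) (code v) 2 (suc-injective e)))
code-injective (zero ∷ u)     (suc zero ∷ v) e = ⊥-elim (even≢odd (code u) (code v) (suc-injective e))
code-injective (suc zero ∷ u) (zero ∷ v)     e = ⊥-elim (even≢odd (code v) (code u) (sym (suc-injective e)))
code-injective (suc zero ∷ u) (suc zero ∷ v) e =
  cong (b₁ ∷_) (code-injective u v (*-cancelˡ-≡ (code u) (code v) 2 (suc-injective (suc-injective e))))

2*m+2+2≡2*[m+2] : ∀ m → suc (suc (2 * m)) + 2 ≡ 2 * (m + 2)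
2*m+2+2≡2*[m+2] = solve-∀

2^length≤1+code : ∀ (w : Bin) → 2 ^ length w ≤ suc (code w)
2^length≤1+code []      = ≤-refl
2^length≤1+code (a ∷ w) = begin
  2 * 2 ^ length w      ≤⟨ *-monoʳ-≤ 2 (2^length≤1+code w) ⟩
  2 * suc (code w)      ≡⟨ *-suc 2 (code w) ⟩
  2 + 2 * code w        ≤⟨ s≤s (s≤s (m≤n+m (2 * code w) (toℕ a))) ⟩
  suc (code (a ∷ w))    ∎
  where open ≤-Reasoning

code+2≤2^1+length : ∀ (w : Bin) → code w + 2 ≤ 2 ^ suc (length w)
code+2≤2^1+length []      = ≤-refl
code+2≤2^1+length (a ∷ w) = begin
  code (a ∷ w) + 2      ≤⟨ +-monoˡ-≤ 2 (+-monoˡ-≤ (2 * code w) (toℕ<n a)) ⟩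
  2 + 2 * code w + 2    ≡⟨ 2*m+2+2≡2*[m+2] (code w) ⟩
  2 * (code w + 2)      ≤⟨ *-monoʳ-≤ 2 (code+2≤2^1+length w) ⟩
  2 * 2 ^ suc (length w) ∎
  where open ≤-Reasoning

bitLength : ℕ → ℕ
bitLength k = length (decode k)

2^bitLength≤1+k : ∀ k → 2 ^ bitLength k ≤ suc k
2^bitLength≤1+k k = subst (λ c → 2 ^ bitLength k ≤ suc c) (code-decode k) (2^length≤1+code (decode k))

k+2≤2^1+bitLength : ∀ k → k + 2 ≤ 2 ^ suc (bitLength k)
k+2≤2^1+bitLength k = subst (λ c → c + 2 ≤ 2 ^ suc (bitLength k)) (code-decode k) (code+2≤2^1+length (decode k))

-- Self-delimiting binary words 1ᴸ 0 w with L = length w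

ones : ℕ → Bin
ones n = replicate n b₁

selfDelimit : Bin → Bin
selfDelimit w = ones (length w) ++ b₀ ∷ w

length-selfDelimit : ∀ w → length (selfDelimit w) ≡ length w + suc (length w)
length-selfDelimit w = trans (length-++ (ones (length w))) (cong (_+ suc (length w)) (length-replicate (length w)))

ones-0-injective : ∀ n n' u u' → ones n ++ b₀ ∷ u ≡ ones n' ++ b₀ ∷ u' → n ≡ n' × u ≡ u'
ones-0-injective zero    zero     u u' refl = refl , refl
ones-0-injective (suc n) (suc n') u u' e with ones-0-injective n n' u u' (∷-injectiveʳ e)
... | refl , u≡u' = refl , u≡u'

length-++-≡⇒[] : ∀ {A : Set} (w r : List A) → length (w ++ r) ≡ length w → r ≡ []
length-++-≡⇒[] []      []      _ = refl
length-++-≡⇒[] (_ ∷ w) r       e = length-++-≡⇒[] w r (suc-injective e)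

selfDelimit-prefixFree : ∀ w w' r → selfDelimit w ++ r ≡ selfDelimit w' → r ≡ []
selfDelimit-prefixFree w w' r e
  with ones-0-injective (length w) (length w') (w ++ r) w' (trans (sym (++-assoc (ones (length w)) (b₀ ∷ w) r)) e)
... | |w|≡|w'| , w++r≡w' = length-++-≡⇒[] w r (trans (cong length w++r≡w') (sym |w|≡|w'|))

code-ones-++ : ∀ n u → code (ones n ++ u) + 2 ≡ 2 ^ n * (code u + 2)
code-ones-++ zero    u = sym (+-identityʳ _)
code-ones-++ (suc n) u = begin
  suc (suc (2 * code (ones n ++ u))) + 2 ≡⟨ 2*m+2+2≡2*[m+2] (code (ones n ++ u)) ⟩
  2 * (code (ones n ++ u) + 2)            ≡⟨ cong (2 *_) (code-ones-++ n u) ⟩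
  2 * (2 ^ n * (code u + 2))              ≡⟨ *-assoc 2 (2 ^ n) _ ⟨
  2 ^ suc n * (code u + 2)                ∎
  where open ≡-Reasoning

-- code (selfDelimit (decode k)) + 2, in a closed form that MUL, POW2 and ADD can compute
selfDelimitCode : ℕ → ℕ
selfDelimitCode k = 2 ^ bitLength k * suc (suc (suc (k + k)))

code-selfDelimit-decode : ∀ k → code (selfDelimit (decode k)) + 2 ≡ selfDelimitCode k
code-selfDelimit-decode k = begin
  code (selfDelimit w) + 2                         ≡⟨ code-ones-++ (length w) (b₀ ∷ w) ⟩
  2 ^ length w * (suc (2 * code w) + 2)            ≡⟨ cong (2 ^ length w *_) (1+2*m+2≡3+m+m (code w)) ⟩
  2 ^ length w * suc (suc (suc (code w + code w))) ≡⟨ cong (λ c → 2 ^ length w * suc (suc (suc (c + c))))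
                                                           (code-decode k) ⟩
  selfDelimitCode k                                ∎
  where
  open ≡-Reasoning
  w = decode k
  1+2*m+2≡3+m+m : ∀ m → suc (2 * m) + 2 ≡ suc (suc (suc (m + m)))
  1+2*m+2≡3+m+m = solve-∀

selfDelimitCode-injective : ∀ k k' → selfDelimitCode k ≡ selfDelimitCode k' → k ≡ k'
selfDelimitCode-injective k k' e
  with ones-0-injective (bitLength k) (bitLength k') (decode k) (decode k')
         (code-injective (selfDelimit (decode k)) (selfDelimit (decode k'))
           (+-cancelʳ-≡ 2 _ _ (trans (code-selfDelimit-decode k) (trans e (sym (code-selfDelimit-decode k'))))))
... | _ , decode-k≡decode-k' = trans (sym (code-decode k)) (trans (cong code decode-k≡decode-k') (code-decode k'))

-- (k + 2) ∸ 2 ^ (L + 1) vanishes first at L = bitLength k.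
BITLEN : Prog 1
BITLEN = Mu (C₂ MONUS (C₁ S (C₁ S P₁)) (C₁ POW2 (C₁ S P₀)))

BITLEN-computes : Computes BITLEN (λ { (k ∷ []) → bitLength k })
BITLEN-computes =
  Mu-computes (C₂-computes MONUS-computes (C₁-computes S-computes (C₁-computes S-computes (P-computes (suc zero))))
                                          (C₁-computes POW2-computes (C₁-computes S-computes (P-computes zero))))
    (λ { (k ∷ []) → m≤n⇒m∸n≡0 (subst (_≤ 2 ^ suc (bitLength k)) (+-comm k 2) (k+2≤2^1+bitLength k)) })
    (λ { (k ∷ []) L L<bitLength e →
         1+n≰n (≤-trans (m∸n≡0⇒m≤n e) (≤-trans (^-monoʳ-≤ 2 L<bitLength) (2^bitLength≤1+k k))) })

SDCODE : Prog 1
SDCODE = C₂ MUL (C₁ POW2 BITLEN) (C₁ S (C₁ S (C₁ S (C₂ ADD P₀ P₀))))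

SDCODE-computes : Computes SDCODE (λ { (k ∷ []) → selfDelimitCode k })
SDCODE-computes = computes-≗
  (C₂-computes MUL-computes (C₁-computes POW2-computes BITLEN-computes)
    (C₁-computes S-computes (C₁-computes S-computes (C₁-computes S-computes
      (C₂-computes ADD-computes (P-computes zero) (P-computes zero))))))
  λ { (k ∷ []) → refl }

MISMATCH : Prog 2
MISMATCH = C₂ DIST (C₁ S (C₁ S P₁)) (C₁ SDCODE P₀)

mismatch : Vec ℕ 2 → ℕ
mismatch (k ∷ n ∷ []) = ∣ n + 2 - selfDelimitCode k ∣

MISMATCH-computes : Computes MISMATCH mismatch
MISMATCH-computes = computes-≗
  (C₂-computes DIST-computes (C₁-computes S-computes (C₁-computes S-computes (P-computes (suc zero))))
                             (C₁-computes SDCODE-computes (P-computes zero)))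
  λ { (k ∷ n ∷ []) → cong (λ m → ∣ m - selfDelimitCode k ∣) (+-comm 2 n) }

-- On input code p, search for k with p = selfDelimit (decode k), then run e on k.
prefixMachine : Prog 1 → Prog 1
prefixMachine e = C₁ e (Mu MISMATCH)

prefixMachine-domain : ∀ e (p : Bin) {y} → prefixMachine e ⊢ code p ↦ y → ∃ λ k → p ≡ selfDelimit (decode k)
prefixMachine-domain e p (suc f , halts) with eval f (Mu MISMATCH) (code p ∷ []) in found
... | just k = k , code-injective p (selfDelimit (decode k))
                     (+-cancelʳ-≡ 2 _ _ (trans (∣m-n∣≡0⇒m≡n (Mu-sound MISMATCH-computes (code p ∷ []) f found))
                                               (sym (code-selfDelimit-decode k))))

prefixMachine-prefixFree : ∀ e → PrefixFree (prefixMachine e)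
prefixMachine-prefixFree e p q _ _ p-halts q-halts (r , p++r≡q)
  with prefixMachine-domain e p p-halts | prefixMachine-domain e q q-halts
... | k , refl | k' , refl =
  trans (sym (++-identityʳ _))
        (trans (cong (selfDelimit (decode k) ++_) (sym (selfDelimit-prefixFree _ _ r p++r≡q))) p++r≡q)

prefixMachine-runs : ∀ e k {y} → e ⊢ k ↦ y → prefixMachine e ⊢ code (selfDelimit (decode k)) ↦ y
prefixMachine-runs e k e-halts = C₁-halts decodes e-halts
  where
  n = code (selfDelimit (decode k))
  n+2≡ : n + 2 ≡ selfDelimitCode k
  n+2≡ = code-selfDelimit-decode k
  decodes : ∃ λ f → eval f (Mu MISMATCH) (n ∷ []) ≡ just k
  decodes = Mu-complete MISMATCH-computes (n ∷ []) k (m≡n⇒∣m-n∣≡0 n+2≡)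
    λ k' k'<k e → <-irrefl (selfDelimitCode-injective k' k (trans (sym (∣m-n∣≡0⇒m≡n e)) n+2≡)) k'<k

-- Length estimates

n<2^n : ∀ n → n < 2 ^ n
n<2^n zero    = s≤s z≤n
n<2^n (suc n) = +-mono-≤ (m^n>0 2 n) (≤-trans (n<2^n n) (≤-reflexive (sym (+-identityʳ (2 ^ n)))))

2^-cancel-≤ : ∀ {m n} → 2 ^ m ≤ 2 ^ n → m ≤ n
2^-cancel-≤ le = ≮⇒≥ λ n<m → <⇒≱ (^-monoʳ-< 2 (s≤s (s≤s z≤n)) n<m) le

1+code≤[1+k]^length : ∀ {k} (x : Str k) → suc (code x) ≤ suc k ^ length x
1+code≤[1+k]^length []          = ≤-refl
1+code≤[1+k]^length {k} (a ∷ w) = begin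
  suc (suc (toℕ a) + k * code w) ≤⟨ s≤s (+-monoˡ-≤ (k * code w) (toℕ<n a)) ⟩
  suc (k + k * code w)           ≤⟨ s≤s (m≤n+m _ (code w)) ⟩
  suc (code w + (k + k * code w)) ≡⟨ cong (λ c → suc (code w + c)) (*-suc k (code w)) ⟨
  suc k * suc (code w)           ≤⟨ *-monoʳ-≤ (suc k) (1+code≤[1+k]^length w) ⟩
  suc k * suc k ^ length w       ∎
  where open ≤-Reasoning

bitLength-code≤ : ∀ {k} (x : Str k) → bitLength (code x) ≤ suc k * length x
bitLength-code≤ {k} x = 2^-cancel-≤ (begin
  2 ^ bitLength (code x)   ≤⟨ 2^bitLength≤1+k (code x) ⟩
  suc (code x)             ≤⟨ 1+code≤[1+k]^length x ⟩
  suc k ^ length x         ≤⟨ ^-monoˡ-≤ (length x) (<⇒≤ (n<2^n (suc k))) ⟩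
  (2 ^ suc k) ^ length x   ≡⟨ ^-*-assoc 2 (suc k) (length x) ⟩
  2 ^ (suc k * length x)   ∎)
  where open ≤-Reasoning

L+1+L+c≤ : ∀ {L B l} c → L ≤ B * suc l → L + suc L + c ≤ (B + suc B + c) * suc l
L+1+L+c≤ {L} {B} {l} c L≤Bn = begin
  L + suc L + c               ≤⟨ +-mono-≤ (+-mono-≤ L≤Bn (s≤s L≤Bn)) (m≤m*n c n) ⟩
  B * n + suc (B * n) + c * n ≤⟨ +-monoˡ-≤ (c * n) (+-monoʳ-≤ (B * n) (+-monoˡ-≤ (B * n) (s≤s (z≤n {l})))) ⟩
  B * n + (n + B * n) + c * n ≡⟨ cong (_+ c * n) (*-distribʳ-+ n B (suc B)) ⟨
  (B + suc B) * n + c * n     ≡⟨ *-distribʳ-+ n (B + suc B) c ⟨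
  (B + suc B + c) * n         ∎
  where
  open ≤-Reasoning
  n = suc l

≤-*⇒/≤ : ∀ {h M l} → h ≤ M * suc l → (+ h) ℚ./ suc l ℚ.≤ (+ M) ℚ./ 1
≤-*⇒/≤ {h} {M} {l} h≤Ml = ℚ.*≤* (subst₂ ℤ._≤_ (ℤ.pos-* h 1) (ℤ.pos-* M (suc l))
                                    (ℤ.+≤+ (subst (_≤ M * suc l) (sym (*-identityʳ h)) h≤Ml)))

lemma5p5 : (U₂ : Prog 1) → Universal U₂ →
    (i : ℕ) → i ≥ 2 → (g : GödelNumbering i) →
    ∃ λ (M : ℚ.ℚᵘ) → ∀ (x : Str i) (h : ℕ) →
    IsH U₂ (proj₁ g x) h → ρ¹ x h ℚ.≤ M
lemma5p5 U₂ (_ , simulate) i _ (g , (e , e-computes-g) , _)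
  with simulate (prefixMachine e) (prefixMachine-prefixFree e)
... | c , simulates = (+ M) ℚ./ 1 , ρ¹≤M
  where
  M : ℕ
  M = suc i + suc (suc i) + c

  ρ¹≤M : ∀ x h → IsH U₂ (g x) h → ρ¹ x h ℚ.≤ (+ M) ℚ./ 1
  ρ¹≤M []        h _ = ≤-*⇒/≤ {0} {M} {0} z≤n
  ρ¹≤M x@(_ ∷ w) h (_ , minimal) =
    let w' = decode (code x)
        p , U₂-runs , |p|≤ = simulates (selfDelimit w') (g x) (prefixMachine-runs e (code x) (e-computes-g x))
    in ≤-*⇒/≤ (begin
      h                               ≤⟨ minimal p U₂-runs ⟩
      length p                        ≤⟨ |p|≤ ⟩
      length (selfDelimit w') + c     ≡⟨ cong (_+ c) (length-selfDelimit w') ⟩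
      length w' + suc (length w') + c ≤⟨ L+1+L+c≤ {B = suc i} {l = length w} c (bitLength-code≤ x) ⟩
      M * suc (length w)              ∎)
    where open ≤-Reasoning
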